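{- Let $\alpha=(\alpha_1,\alpha_2,\alpha_3,\alpha_4)$ be a partition with exactly $h=4$ parts such that $\alpha\notin\mathrm{Sign}$, $(\alpha_2,\alpha_3,\alpha_4)\in\mathrm{Sign}$, $\alpha_1>\alpha_2>\alpha_3+\alpha_4$, and $\alpha_1-\alpha_2=\alpha_4=1<\alpha_3$. Then $\beta=(\alpha_1-2,\alpha_3,\alpha_3,4,1^{\alpha_1-\alpha_3-2})$ is a partition with $h^\beta_{2,1}=\alpha_1$ and $\chi^\beta_\alpha=2(-1)^{\alpha_1-\alpha_3}$.
   Context: $(b_1,\ldots,b_t,1^m)$ denotes the partition with parts $b_1,\ldots,b_t$ followed by $m$ parts equal to $1$. $h^\lambda_{i,j}$ is the hook length of node $(i,j)$ (row $i$, column $j$) of the Young diagram of $\lambda$. For partitions $\lambda,\mu$ of the same $n$, $\chi^\lambda_\mu$ is the value of the irreducible character of $S_n$ labeled by $\lambda$ on permutations of cycle type $\mu$. $\mathrm{Sign}$ denotes the set of all partitions $(\gamma_1,\ldots,\gamma_r)$ for which there exists $s$ with $0\leq s\leq r$ such that: (i) $\gamma_i>\gamma_{i+1}+\cdots+\gamma_r$ for $1\leq i\leq s$; and (ii) $(\gamma_{s+1},\ldots,\gamma_r)$ is one of $()$, $(1,1)$, $(3,2,1,1)$, $(5,3,2,1)$, $(a,a-1,1)$ with $a\geq 2$, $(a,a-1,2,1)$ with $a\geq 4$, or $(a,a-1,3,1)$ with $a\geq 5$. -}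

module Defs where

open import Data.Bool using (Bool; true; false; if_then_else_; _∧_; not)
open import Data.Nat using (ℕ; zero; suc; _+_; _∸_; _<_; _≤_; _≥_; _≤ᵇ_; _<ᵇ_; _≡ᵇ_)
open import Data.Integer as ℤ using (ℤ)
open import Data.List using (List; []; _∷_; _++_; length; map; filter; foldr)
open import Data.Nat.ListAction using (sum)
open import Data.Bool.ListAction using (all; any)
open import Data.List.Relation.Unary.All using (All)
open import Data.List.Relation.Unary.Linked using (Linked)
open import Data.Product using (_×_; ∃₂)
open import Data.Unit using (⊤)
open import Relation.Binary.PropositionalEquality using (_≡_)
open import Relation.Nullary.Decidable using (does; _×-dec_)

IsPartition : List ℕ → Set
IsPartition λ′ = All (0 <_) λ′ × Linked _≥_ λ′

data SignTail : List ℕ → Set where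
  st-nil  : SignTail []
  st-11   : SignTail (1 ∷ 1 ∷ [])
  st-3211 : SignTail (3 ∷ 2 ∷ 1 ∷ 1 ∷ [])
  st-5321 : SignTail (5 ∷ 3 ∷ 2 ∷ 1 ∷ [])
  st-a1   : ∀ a → 2 ≤ a → SignTail (a ∷ a ∸ 1 ∷ 1 ∷ [])
  st-a21  : ∀ a → 4 ≤ a → SignTail (a ∷ a ∸ 1 ∷ 2 ∷ 1 ∷ [])
  st-a31  : ∀ a → 5 ≤ a → SignTail (a ∷ a ∸ 1 ∷ 3 ∷ 1 ∷ [])

DomPrefix : List ℕ → List ℕ → Set
DomPrefix []       t = ⊤
DomPrefix (x ∷ xs) t = (sum xs + sum t < x) × DomPrefix xs t

InSign : List ℕ → Set
InSign γ = IsPartition γ ×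
  ∃₂ λ p t → (γ ≡ p ++ t) × DomPrefix p t × SignTail t

-- Hook lengths (1-indexed rows i and columns j).

nth : List ℕ → ℕ → ℕ
nth []       _       = 0
nth (x ∷ xs) zero    = x
nth (x ∷ xs) (suc k) = nth xs k

conjPart : List ℕ → ℕ → ℕ
conjPart λ′ j = length (filter (λ x → j Data.Nat.≤? x) λ′)

hook : List ℕ → ℕ → ℕ → ℕ
hook λ′ i j = (nth λ′ (i ∸ 1) ∸ j) + (conjPart λ′ j ∸ i) + 1

-- Irreducible characters of S_n, via the Murnaghan–Nakayama rule
-- on beta-sets (first-column hook lengths).

betaSet : List ℕ → List ℕ
betaSet []       = []
betaSet (x ∷ xs) = (x + length xs) ∷ betaSet xs

elemᵇ : ℕ → List ℕ → Bool
elemᵇ x B = any (λ c → c ≡ᵇ x) B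

-- number of elements c of B with lo < c < hi  (leg length of the rim hook)
between : ℕ → ℕ → List ℕ → ℕ
between lo hi B = length (filter (λ c → (lo Data.Nat.<? c) ×-dec (c Data.Nat.<? hi)) B)

replaceᵇ : ℕ → ℕ → List ℕ → List ℕ
replaceᵇ b b′ B = map (λ c → if c ≡ᵇ b then b′ else c) B

negOnePow : ℕ → ℤ
negOnePow zero    = ℤ.1ℤ
negOnePow (suc k) = ℤ.- negOnePow k

sumℤ : List ℤ → ℤ
sumℤ = foldr ℤ._+_ ℤ.0ℤ

-- MN recursion: remove a rim hook of length r (= move a bead b to b - r,
-- if that position is free), with sign (-1)^(leg length).
-- Base case: the beta-set of the empty partition is {0,…,|B|-1}.
mn : List ℕ → List ℕ → ℤ
mn B []      = if all (λ b → b <ᵇ length B) B then ℤ.1ℤ else ℤ.0ℤ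
mn B (r ∷ μ) = sumℤ (map term B)
  where
  term : ℕ → ℤ
  term b = if (r ≤ᵇ b) ∧ not (elemᵇ (b ∸ r) B)
           then negOnePow (between (b ∸ r) b B) ℤ.* mn (replaceᵇ b (b ∸ r) B) μ
           else ℤ.0ℤ

χ : List ℕ → List ℕ → ℤ
χ λ′ μ = mn (betaSet λ′) μ

{-# OPTIONS --safe #-}
-- Write α₃ = c and α₂ = c + 1 + j.  For c = 2, 3 the partition α would lie in Sign, with
-- tail (a, a−1, 2, 1) or (a, a−1, 3, 1); so c ≥ 4, and j ≥ 1 since α₂ > α₃ + α₄.  Then
-- β = (c+j, c, c, 4, 1ʲ), h^β_{2,1} = (c − 1) + (j + 2) + 1 = α₁, and the beta-set of β is
-- {c+2j+3, c+j+2, c+j+1, j+4} ∪ {1, …, j}.  Running the Murnaghan–Nakayama rule on beads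
-- for the hooks α₁ = c+j+2, α₂ = c+j+1, α₃ = c, α₄ = 1, exactly two chains of bead moves
-- survive, with leg lengths (3, j+2, 1, 0) and (j+2, 2, 2, 0).  Each contributes (−1)ʲ,
-- so χ^β_α = 2(−1)ʲ = 2(−1)^(α₁−α₃).
module Submission where

open import Defs
open import Data.Bool using (true; false; if_then_else_; _∧_; not)
open import Data.Bool.ListAction using (all)
open import Data.Bool.Properties using (∨-zeroʳ)
open import Data.Nat
open import Data.Nat.Properties
open import Algebra.Properties.CommutativeSemigroup +-commutativeSemigroup using (x∙yz≈y∙xz)
open import Data.Integer as ℤ using (ℤ)
import Data.Integer.Tactic.RingSolver as ℤ-Solver
open import Data.List using (List; []; _∷_; _++_; map; length; replicate)
open import Data.List.Properties using (length-replicate; filter-all)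
open import Data.List.Membership.Propositional using (_∈_)
open import Data.List.Membership.Propositional.Properties using (∈-++⁺ˡ; ∈-++⁺ʳ)
open import Data.List.Relation.Unary.All using (All; []; _∷_)
open import Data.List.Relation.Unary.All.Properties using (replicate⁺)
open import Data.List.Relation.Unary.Any using (here; there)
open import Data.List.Relation.Unary.Linked using (Linked; []; [-]; _∷_)
open import Data.List.Relation.Binary.Pointwise using (Pointwise; []; _∷_)
open import Data.Product using (_×_; _,_; proj₁)
open import Data.Unit using (tt)
open import Data.Empty using (⊥-elim)
open import Function using (_∘_)
open import Relation.Nullary using (¬_; yes; no)
open import Relation.Nullary.Decidable using (dec-true; dec-false; _×-dec_)
open import Relation.Binary.PropositionalEquality

oneTo : ℕ → List ℕ
oneTo zero    = []
oneTo (suc j) = suc j ∷ oneTo j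

length-oneTo : ∀ j → length (oneTo j) ≡ j
length-oneTo zero    = refl
length-oneTo (suc j) = cong suc (length-oneTo j)

betaSet-replicate-1 : ∀ j → betaSet (replicate j 1) ≡ oneTo j
betaSet-replicate-1 zero    = refl
betaSet-replicate-1 (suc j) =
  cong₂ _∷_ (cong suc (length-replicate j)) (betaSet-replicate-1 j)

oneTo⁺ : ∀ {P : ℕ → Set} {j} → (∀ {b} → 1 ≤ b → b ≤ j → P b) → All P (oneTo j)
oneTo⁺ {j = zero}  p = []
oneTo⁺ {j = suc j} p = p (s≤s z≤n) ≤-refl ∷ oneTo⁺ (λ 1≤b b≤j → p 1≤b (m≤n⇒m≤1+n b≤j))

∈-oneTo : ∀ {x j} → 1 ≤ x → x ≤ j → x ∈ oneTo j
∈-oneTo {j = zero}  (s≤s _) ()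
∈-oneTo {x} {suc j} 1≤x x≤1+j with x ≟ suc j
... | yes refl  = here refl
... | no  x≢1+j = there (∈-oneTo 1≤x (≤-pred (≤∧≢⇒< x≤1+j x≢1+j)))

oneTo-∌ : ∀ {x j} → j < x → All (x ≢_) (oneTo j)
oneTo-∌ j<x = oneTo⁺ (λ _ b≤j → >⇒≢ (≤-<-trans b≤j j<x))

oneTo-∌0 : ∀ {j} → All (0 ≢_) (oneTo j)
oneTo-∌0 = oneTo⁺ (λ 1≤b _ → <⇒≢ 1≤b)

∈-column : ∀ xs {x j} → 0 ∈ xs → x ≤ j → x ∈ xs ++ oneTo j
∈-column xs 0∈xs z≤n          = ∈-++⁺ˡ 0∈xs
∈-column xs 0∈xs x≤j@(s≤s _) = ∈-++⁺ʳ xs (∈-oneTo (s≤s z≤n) x≤j)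

∈⇒elemᵇ : ∀ {x B} → x ∈ B → elemᵇ x B ≡ true
∈⇒elemᵇ {x} (here refl) rewrite dec-true (x ≟ x) refl = refl
∈⇒elemᵇ {x} {y ∷ _} (there x∈B) rewrite ∈⇒elemᵇ x∈B = ∨-zeroʳ (y ≡ᵇ x)

∌⇒elemᵇ : ∀ {x B} → All (x ≢_) B → elemᵇ x B ≡ false
∌⇒elemᵇ []                            = refl
∌⇒elemᵇ {x} {y ∷ _} (x≢y ∷ x∌B) rewrite dec-false (y ≟ x) (x≢y ∘ sym) = ∌⇒elemᵇ x∌B

data Between (lo hi : ℕ) : List ℕ → ℕ → Set where
  []     : Between lo hi [] 0
  inside : ∀ {x xs k} → lo < x → x < hi → Between lo hi xs k → Between lo hi (x ∷ xs) (suc k)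
  below  : ∀ {x xs k} → x ≤ lo → Between lo hi xs k → Between lo hi (x ∷ xs) k
  above  : ∀ {x xs k} → hi ≤ x → Between lo hi xs k → Between lo hi (x ∷ xs) k

Between⇒between : ∀ {lo hi B k} → Between lo hi B k → between lo hi B ≡ k
Between⇒between [] = refl
Between⇒between {lo} {hi} (inside {x} lo<x x<hi t)
  rewrite dec-true ((lo <? x) ×-dec (x <? hi)) (lo<x , x<hi) = cong suc (Between⇒between t)
Between⇒between {lo} {hi} (below {x} x≤lo t)
  rewrite dec-false ((lo <? x) ×-dec (x <? hi)) (λ (lo<x , _) → <⇒≱ lo<x x≤lo) = Between⇒between t
Between⇒between {lo} {hi} (above {x} hi≤x t)
  rewrite dec-false ((lo <? x) ×-dec (x <? hi)) (λ (_ , x<hi) → <⇒≱ x<hi hi≤x) = Between⇒between t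

oneTo-below : ∀ {lo hi j} → j ≤ lo → Between lo hi (oneTo j) 0
oneTo-below {j = zero}  _   = []
oneTo-below {j = suc j} j≤lo = below j≤lo (oneTo-below (≤-trans (n≤1+n j) j≤lo))

oneTo-inside : ∀ {hi j} → j < hi → Between 0 hi (oneTo j) j
oneTo-inside {j = zero}  _    = []
oneTo-inside {j = suc j} j<hi = inside z<s j<hi (oneTo-inside (<-trans (n<1+n j) j<hi))

replaceᵇ-∌ : ∀ {b x B} → All (b ≢_) B → replaceᵇ b x B ≡ B
replaceᵇ-∌ [] = refl
replaceᵇ-∌ {b} {x} {y ∷ _} (b≢y ∷ b∌B)
  rewrite dec-false (y ≟ b) (b≢y ∘ sym) = cong (y ∷_) (replaceᵇ-∌ b∌B)

replaceᵇ-once : ∀ {b x ys zs} → All (b ≢_) ys → All (b ≢_) zs →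
                replaceᵇ b x (ys ++ b ∷ zs) ≡ ys ++ x ∷ zs
replaceᵇ-once {b} [] b∌zs rewrite dec-true (b ≟ b) refl = cong (_ ∷_) (replaceᵇ-∌ b∌zs)
replaceᵇ-once {b} {ys = y ∷ _} (b≢y ∷ b∌ys) b∌zs
  rewrite dec-false (y ≟ b) (b≢y ∘ sym) = cong (y ∷_) (replaceᵇ-once b∌ys b∌zs)

-- The summand of the `where` clause of `mn`, so that
-- mn B (r ∷ μ) is sumℤ (map (mnTerm B r μ) B) by definition.
mnTerm : List ℕ → ℕ → List ℕ → ℕ → ℤ
mnTerm B r μ b = if (r ≤ᵇ b) ∧ not (elemᵇ (b ∸ r) B)
                 then negOnePow (between (b ∸ r) b B) ℤ.* mn (replaceᵇ b (b ∸ r) B) μ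
                 else ℤ.0ℤ

data Move (B : List ℕ) (r : ℕ) (μ : List ℕ) (b : ℕ) : ℤ → Set where
  short   : b < r → Move B r μ b ℤ.0ℤ
  blocked : ∀ {x} → b ∸ r ≡ x → x ∈ B → Move B r μ b ℤ.0ℤ
  slide   : ∀ {x k v} B′ → r + x ≡ b → All (x ≢_) B → Between x b B k →
            replaceᵇ b x B ≡ B′ → mn B′ μ ≡ v → Move B r μ b (negOnePow k ℤ.* v)

Move⇒mnTerm : ∀ {B r μ b v} → Move B r μ b v → mnTerm B r μ b ≡ v
Move⇒mnTerm {r = r} {b = b} (short b<r) rewrite dec-false (r ≤? b) (<⇒≱ b<r) = refl
Move⇒mnTerm {r = r} {b = b} (blocked refl x∈B) with r ≤ᵇ b
... | false = refl
... | true  rewrite ∈⇒elemᵇ x∈B = refl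
Move⇒mnTerm {r = r} (slide {x} _ refl x∌B t refl refl)
  rewrite dec-true (r ≤? r + x) (m≤m+n r x) | m+n∸m≡n r x | ∌⇒elemᵇ x∌B | Between⇒between t = refl

-- B, r, μ here and B′ in slide are explicit because inferring them would mean
-- inverting mn, which the unifier can only attempt by unfolding it.
mn-∷ : ∀ B r μ {xs ys vs} → B ≡ xs ++ ys → Pointwise (Move B r μ) xs vs →
       All (λ b → Move B r μ b ℤ.0ℤ) ys → mn B (r ∷ μ) ≡ sumℤ vs
mn-∷ B r μ {ys = ys} refl moves idle = sum-moves moves
  where
  term : ℕ → ℤ
  term = mnTerm B r μ

  sum-idle : ∀ {zs} → All (λ b → Move B r μ b ℤ.0ℤ) zs → sumℤ (map term zs) ≡ ℤ.0ℤ
  sum-idle []       = refl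
  sum-idle (m ∷ ms) = cong₂ ℤ._+_ (Move⇒mnTerm m) (sum-idle ms)

  sum-moves : ∀ {zs vs} → Pointwise (Move B r μ) zs vs →
              sumℤ (map term (zs ++ ys)) ≡ sumℤ vs
  sum-moves []       = sum-idle idle
  sum-moves (m ∷ ms) = cong₂ ℤ._+_ (Move⇒mnTerm m) (sum-moves ms)

oneTo-short : ∀ {B r μ j} → j < r → All (λ b → Move B r μ b ℤ.0ℤ) (oneTo j)
oneTo-short j<r = oneTo⁺ (λ _ b≤j → short (≤-<-trans b≤j j<r))

oneTo-blocked : ∀ {B r μ j} → (∀ {x} → x ≤ j → x ∈ B) → All (λ b → Move B r μ b ℤ.0ℤ) (oneTo j)
oneTo-blocked {r = r} ≤j⇒∈B = oneTo⁺ (λ {b} _ b≤j → blocked refl (≤j⇒∈B (≤-trans (m∸n≤m b r) b≤j)))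

all-<ᵇ : ∀ {n xs} → All (_< n) xs → all (_<ᵇ n) xs ≡ true
all-<ᵇ []                      = refl
all-<ᵇ {n} (_∷_ {x} x<n xs<n) rewrite dec-true (x <? n) x<n = all-<ᵇ xs<n

mn-[] : ∀ {B n} → length B ≡ n → All (_< n) B → mn B [] ≡ ℤ.1ℤ
mn-[] refl <n rewrite all-<ᵇ <n = refl

k+j∸c≤j : ∀ {k c} j → k ≤ c → k + j ∸ c ≤ j
k+j∸c≤j {k} j k≤c = ≤-trans (∸-monoʳ-≤ (k + j) k≤c) (≤-reflexive (m+n∸m≡n k j))

Linked-replicate-1 : ∀ {x} k → 1 ≤ x → Linked _≥_ (x ∷ replicate k 1)
Linked-replicate-1 zero    _   = [-]
Linked-replicate-1 (suc k) 1≤x = 1≤x ∷ Linked-replicate-1 k ≤-refl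

isPartition-[n,c,c,4,1ᵏ] : ∀ {n c} k → 4 ≤ c → c ≤ n → IsPartition (n ∷ c ∷ c ∷ 4 ∷ replicate k 1)
isPartition-[n,c,c,4,1ᵏ] {c = c} k 4≤c c≤n =
  (≤-trans 0<c c≤n ∷ 0<c ∷ 0<c ∷ z<s ∷ replicate⁺ k z<s) ,
  (c≤n ∷ ≤-refl ∷ 4≤c ∷ Linked-replicate-1 k (s≤s z≤n))
  where
  0<c : 0 < c
  0<c = ≤-trans (s≤s z≤n) 4≤c

hook-2-1 : ∀ {λ′} → All (0 <_) λ′ → hook λ′ 2 1 ≡ nth λ′ 1 ∸ 1 + (length λ′ ∸ 2) + 1
hook-2-1 {λ′} pos = cong (λ ℓ → nth λ′ 1 ∸ 1 + (ℓ ∸ 2) + 1) (cong length (filter-all (1 ≤?_) pos))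

hook-[n,c,c,4,1ᵏ] : ∀ {n c} k → 4 ≤ c → c ≤ n → hook (n ∷ c ∷ c ∷ 4 ∷ replicate k 1) 2 1 ≡ c + (2 + k)
hook-[n,c,c,4,1ᵏ] {n} {suc c₀} k 4≤c c≤n = begin
  hook (n ∷ suc c₀ ∷ suc c₀ ∷ 4 ∷ replicate k 1) 2 1
    ≡⟨ hook-2-1 (proj₁ (isPartition-[n,c,c,4,1ᵏ] k 4≤c c≤n)) ⟩
  c₀ + (2 + length (replicate k 1)) + 1
    ≡⟨ cong (λ ℓ → c₀ + (2 + ℓ) + 1) (length-replicate k) ⟩
  c₀ + (2 + k) + 1
    ≡⟨ +-comm _ 1 ⟩
  suc c₀ + (2 + k) ∎
  where open ≡-Reasoning

Conclusion : ℕ → ℕ → ℕ → Set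
Conclusion a₁ a₂ a₃ =
    IsPartition ((a₁ ∸ 2) ∷ a₃ ∷ a₃ ∷ 4 ∷ replicate (a₁ ∸ a₃ ∸ 2) 1)
    × hook ((a₁ ∸ 2) ∷ a₃ ∷ a₃ ∷ 4 ∷ replicate (a₁ ∸ a₃ ∸ 2) 1) 2 1 ≡ a₁
    × χ ((a₁ ∸ 2) ∷ a₃ ∷ a₃ ∷ 4 ∷ replicate (a₁ ∸ a₃ ∸ 2) 1) (a₁ ∷ a₂ ∷ a₃ ∷ 1 ∷ [])
        ≡ ℤ.+ 2 ℤ.* negOnePow (a₁ ∸ a₃)

module Character {c j : ℕ} (4≤c : 4 ≤ c) (1≤j : 1 ≤ j) where

  α₂ α₁ top q : ℕ
  α₂  = 1 + (c + j)
  α₁  = 2 + (c + j)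
  top = suc α₁ + j
  q   = 4 + j

  β : List ℕ
  β = α₁ ∸ 2 ∷ c ∷ c ∷ 4 ∷ replicate (α₁ ∸ c ∸ 2) 1

  α : List ℕ
  α = α₁ ∷ α₂ ∷ c ∷ 1 ∷ []

  -- Removing hooks of lengths α₁, α₂, c from B₀ only ever leads along
  -- B₀ → B₁ → B₂ → B₃ and B₀ → C₁ → C₂ → C₃.
  B₀ B₁ B₂ B₃ C₁ C₂ C₃ : List ℕ
  B₀ = top ∷ α₁ ∷ α₂ ∷ q ∷ oneTo j
  B₁ = 1 + j ∷ α₁ ∷ α₂ ∷ q ∷ oneTo j
  B₂ = 1 + j ∷ α₁ ∷ 0 ∷ q ∷ oneTo j
  B₃ = 1 + j ∷ 2 + j ∷ 0 ∷ q ∷ oneTo j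
  C₁ = top ∷ 0 ∷ α₂ ∷ q ∷ oneTo j
  C₂ = 2 + j ∷ 0 ∷ α₂ ∷ q ∷ oneTo j
  C₃ = 2 + j ∷ 0 ∷ 1 + j ∷ q ∷ oneTo j

  j<1+j : j < 1 + j
  j<1+j = n<1+n j
  1+j<2+j : 1 + j < 2 + j
  1+j<2+j = n<1+n _
  2+j<3+j : 2 + j < 3 + j
  2+j<3+j = n<1+n _
  3+j<q : 3 + j < q
  3+j<q = n<1+n _
  q<α₂ : q < α₂
  q<α₂ = s≤s (+-monoˡ-≤ j 4≤c)
  α₂<α₁ : α₂ < α₁
  α₂<α₁ = n<1+n α₂
  α₁<top : α₁ < top
  α₁<top = m≤m+n (suc α₁) j

  j<2+j : j < 2 + j
  j<2+j = <-trans j<1+j 1+j<2+j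
  j<3+j : j < 3 + j
  j<3+j = <-trans j<2+j 2+j<3+j
  1+j<3+j : 1 + j < 3 + j
  1+j<3+j = <-trans 1+j<2+j 2+j<3+j
  2+j<q : 2 + j < q
  2+j<q = <-trans 2+j<3+j 3+j<q
  1+j<q : 1 + j < q
  1+j<q = <-trans 1+j<2+j 2+j<q
  j<q : j < q
  j<q = <-trans j<1+j 1+j<q

  j<α₂ : j < α₂
  j<α₂ = <-trans j<q q<α₂
  1+j<α₂ : 1 + j < α₂
  1+j<α₂ = <-trans 1+j<q q<α₂
  2+j<α₂ : 2 + j < α₂
  2+j<α₂ = <-trans 2+j<q q<α₂
  q<α₁ : q < α₁
  q<α₁ = <-trans q<α₂ α₂<α₁
  j<α₁ : j < α₁
  j<α₁ = <-trans j<α₂ α₂<α₁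
  1+j<α₁ : 1 + j < α₁
  1+j<α₁ = <-trans 1+j<α₂ α₂<α₁
  2+j<α₁ : 2 + j < α₁
  2+j<α₁ = <-trans 2+j<α₂ α₂<α₁
  α₂<top : α₂ < top
  α₂<top = <-trans α₂<α₁ α₁<top
  q<top : q < top
  q<top = <-trans q<α₁ α₁<top
  j<top : j < top
  j<top = <-trans j<α₁ α₁<top
  1+j<top : 1 + j < top
  1+j<top = <-trans 1+j<α₁ α₁<top
  2+j<top : 2 + j < top
  2+j<top = <-trans 2+j<α₂ α₂<top

  1≤c : 1 ≤ c
  1≤c = ≤-trans (s≤s z≤n) 4≤c
  2≤c : 2 ≤ c
  2≤c = ≤-trans (s≤s (s≤s z≤n)) 4≤c

  oneTo<q : All (_< q) (oneTo j)
  oneTo<q = oneTo⁺ (λ _ b≤j → ≤-<-trans b≤j j<q)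

  mn-B₃ : mn B₃ (1 ∷ []) ≡ ℤ.1ℤ
  mn-B₃ = mn-∷ B₃ 1 [] refl
    ( blocked refl (≤j⇒∈B₃ ≤-refl)
    ∷ blocked refl (here refl)
    ∷ short z<s
    ∷ slide _ refl
        (>⇒≢ 1+j<3+j ∷ >⇒≢ 2+j<3+j ∷ 1+n≢0 ∷ <⇒≢ 3+j<q ∷ oneTo-∌ j<3+j)
        (below (<⇒≤ 1+j<3+j) (below (<⇒≤ 2+j<3+j) (below z≤n (above ≤-refl
          (oneTo-below (<⇒≤ j<3+j))))))
        (replaceᵇ-once (>⇒≢ 1+j<q ∷ >⇒≢ 2+j<q ∷ 1+n≢0 ∷ []) (oneTo-∌ j<q))
        (mn-[] (cong (4 +_) (length-oneTo j))
          (1+j<q ∷ 2+j<q ∷ z<s ∷ 3+j<q ∷ oneTo<q))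
    ∷ [])
    (oneTo-blocked ≤j⇒∈B₃)
    where
    ≤j⇒∈B₃ : ∀ {x} → x ≤ j → x ∈ B₃
    ≤j⇒∈B₃ = ∈-column (1 + j ∷ 2 + j ∷ 0 ∷ q ∷ []) (there (there (here refl)))

  mn-B₂ : mn B₂ (c ∷ 1 ∷ []) ≡ ℤ.-1ℤ
  mn-B₂ = mn-∷ B₂ c (1 ∷ []) refl
    ( blocked refl (≤j⇒∈B₂ (k+j∸c≤j j 1≤c))
    ∷ slide B₃ (x∙yz≈y∙xz c 2 j)
        (>⇒≢ 1+j<2+j ∷ <⇒≢ 2+j<α₁ ∷ 1+n≢0 ∷ <⇒≢ 2+j<q ∷ oneTo-∌ j<2+j)
        (below (<⇒≤ 1+j<2+j) (above ≤-refl (below z≤n (inside 2+j<q q<α₁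
          (oneTo-below (<⇒≤ j<2+j))))))
        (replaceᵇ-once (>⇒≢ 1+j<α₁ ∷ []) (1+n≢0 ∷ >⇒≢ q<α₁ ∷ oneTo-∌ j<α₁))
        mn-B₃
    ∷ short 1≤c
    ∷ blocked refl (≤j⇒∈B₂ (k+j∸c≤j j 4≤c))
    ∷ [])
    (oneTo-blocked ≤j⇒∈B₂)
    where
    ≤j⇒∈B₂ : ∀ {x} → x ≤ j → x ∈ B₂
    ≤j⇒∈B₂ = ∈-column (1 + j ∷ α₁ ∷ 0 ∷ q ∷ []) (there (there (here refl)))

  mn-B₁ : mn B₁ (α₂ ∷ c ∷ 1 ∷ []) ≡ ℤ.- negOnePow (2 + j)
  mn-B₁ = trans
    (mn-∷ B₁ α₂ (c ∷ 1 ∷ []) refl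
      ( short 1+j<α₂
      ∷ blocked (m+n∸n≡m 1 α₂) (∈-++⁺ʳ (1 + j ∷ α₁ ∷ α₂ ∷ q ∷ []) (∈-oneTo ≤-refl 1≤j))
      ∷ slide B₂ (+-identityʳ α₂)
          (0≢1+n ∷ 0≢1+n ∷ 0≢1+n ∷ 0≢1+n ∷ oneTo-∌0)
          (inside z<s 1+j<α₂ (above (<⇒≤ α₂<α₁) (above ≤-refl (inside z<s q<α₂
            (oneTo-inside j<α₂)))))
          (replaceᵇ-once (>⇒≢ 1+j<α₂ ∷ <⇒≢ α₂<α₁ ∷ []) (>⇒≢ q<α₂ ∷ oneTo-∌ j<α₂))
          mn-B₂
      ∷ short q<α₂
      ∷ [])
      (oneTo-short j<α₂))
    (drop-zeros (negOnePow (2 + j)))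
    where
    drop-zeros : ∀ s → ℤ.0ℤ ℤ.+ (ℤ.0ℤ ℤ.+ (s ℤ.* ℤ.-1ℤ ℤ.+ ℤ.0ℤ)) ≡ ℤ.- s
    drop-zeros = ℤ-Solver.solve-∀

  mn-C₃ : mn C₃ (1 ∷ []) ≡ ℤ.1ℤ
  mn-C₃ = mn-∷ C₃ 1 [] refl
    ( blocked refl (there (there (here refl)))
    ∷ short z<s
    ∷ blocked refl (≤j⇒∈C₃ ≤-refl)
    ∷ slide _ refl
        (>⇒≢ 2+j<3+j ∷ 1+n≢0 ∷ >⇒≢ 1+j<3+j ∷ <⇒≢ 3+j<q ∷ oneTo-∌ j<3+j)
        (below (<⇒≤ 2+j<3+j) (below z≤n (below (<⇒≤ 1+j<3+j) (above ≤-refl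
          (oneTo-below (<⇒≤ j<3+j))))))
        (replaceᵇ-once (>⇒≢ 2+j<q ∷ 1+n≢0 ∷ >⇒≢ 1+j<q ∷ []) (oneTo-∌ j<q))
        (mn-[] (cong (4 +_) (length-oneTo j)) (2+j<q ∷ z<s ∷ 1+j<q ∷ 3+j<q ∷ oneTo<q))
    ∷ [])
    (oneTo-blocked ≤j⇒∈C₃)
    where
    ≤j⇒∈C₃ : ∀ {x} → x ≤ j → x ∈ C₃
    ≤j⇒∈C₃ = ∈-column (2 + j ∷ 0 ∷ 1 + j ∷ q ∷ []) (there (here refl))

  mn-C₂ : mn C₂ (c ∷ 1 ∷ []) ≡ ℤ.1ℤ
  mn-C₂ = mn-∷ C₂ c (1 ∷ []) refl
    ( blocked refl (≤j⇒∈C₂ (k+j∸c≤j j 2≤c))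
    ∷ short 1≤c
    ∷ slide C₃ (x∙yz≈y∙xz c 1 j)
        (<⇒≢ 1+j<2+j ∷ 1+n≢0 ∷ <⇒≢ 1+j<α₂ ∷ <⇒≢ 1+j<q ∷ oneTo-∌ j<1+j)
        (inside 1+j<2+j 2+j<α₂ (below z≤n (above ≤-refl (inside 1+j<q q<α₂
          (oneTo-below (n≤1+n j))))))
        (replaceᵇ-once (>⇒≢ 2+j<α₂ ∷ 1+n≢0 ∷ []) (>⇒≢ q<α₂ ∷ oneTo-∌ j<α₂))
        mn-C₃
    ∷ blocked refl (≤j⇒∈C₂ (k+j∸c≤j j 4≤c))
    ∷ [])
    (oneTo-blocked ≤j⇒∈C₂)
    where
    ≤j⇒∈C₂ : ∀ {x} → x ≤ j → x ∈ C₂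
    ≤j⇒∈C₂ = ∈-column (2 + j ∷ 0 ∷ α₂ ∷ q ∷ []) (there (here refl))

  mn-C₁ : mn C₁ (α₂ ∷ c ∷ 1 ∷ []) ≡ ℤ.1ℤ
  mn-C₁ = mn-∷ C₁ α₂ (c ∷ 1 ∷ []) refl
    ( slide C₂ (cong suc (x∙yz≈y∙xz (c + j) 2 j))
        (<⇒≢ 2+j<top ∷ 1+n≢0 ∷ <⇒≢ 2+j<α₂ ∷ <⇒≢ 2+j<q ∷ oneTo-∌ j<2+j)
        (above ≤-refl (below z≤n (inside 2+j<α₂ α₂<top (inside 2+j<q q<top
          (oneTo-below (<⇒≤ j<2+j))))))
        (replaceᵇ-once [] (1+n≢0 ∷ >⇒≢ α₂<top ∷ >⇒≢ q<top ∷ oneTo-∌ j<top))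
        mn-C₂
    ∷ short z<s
    ∷ blocked (n∸n≡0 α₂) (there (here refl))
    ∷ short q<α₂
    ∷ [])
    (oneTo-short j<α₂)

  mn-B₀ : mn B₀ α ≡ ℤ.+ 2 ℤ.* negOnePow (2 + j)
  mn-B₀ = trans
    (mn-∷ B₀ α₁ (α₂ ∷ c ∷ 1 ∷ []) refl
      ( slide B₁ (x∙yz≈y∙xz α₁ 1 j)
          (<⇒≢ 1+j<top ∷ <⇒≢ 1+j<α₁ ∷ <⇒≢ 1+j<α₂ ∷ <⇒≢ 1+j<q ∷ oneTo-∌ j<1+j)
          (above ≤-refl (inside 1+j<α₁ α₁<top (inside 1+j<α₂ α₂<top (inside 1+j<q q<top
            (oneTo-below (n≤1+n j))))))
          (replaceᵇ-once [] (>⇒≢ α₁<top ∷ >⇒≢ α₂<top ∷ >⇒≢ q<top ∷ oneTo-∌ j<top))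
          mn-B₁
      ∷ slide C₁ (+-identityʳ α₁)
          (0≢1+n ∷ 0≢1+n ∷ 0≢1+n ∷ 0≢1+n ∷ oneTo-∌0)
          (above (<⇒≤ α₁<top) (above ≤-refl (inside z<s α₂<α₁ (inside z<s q<α₁
            (oneTo-inside j<α₁)))))
          (replaceᵇ-once (<⇒≢ α₁<top ∷ []) (>⇒≢ α₂<α₁ ∷ >⇒≢ q<α₁ ∷ oneTo-∌ j<α₁))
          mn-C₁
      ∷ short α₂<α₁
      ∷ short q<α₁
      ∷ [])
      (oneTo-short j<α₁))
    (collect (negOnePow (2 + j)))
    where
    collect : ∀ s → ℤ.-1ℤ ℤ.* ℤ.- s ℤ.+ (s ℤ.* ℤ.1ℤ ℤ.+ ℤ.0ℤ) ≡ ℤ.+ 2 ℤ.* s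
    collect = ℤ-Solver.solve-∀

  α₁∸c≡2+j : α₁ ∸ c ≡ 2 + j
  α₁∸c≡2+j = trans (cong (_∸ c) (sym (x∙yz≈y∙xz c 2 j))) (m+n∸m≡n c (2 + j))

  betaSet-[c+j,c,c,4,1ʲ] : betaSet (c + j ∷ c ∷ c ∷ 4 ∷ replicate j 1) ≡ B₀
  betaSet-[c+j,c,c,4,1ʲ] rewrite length-replicate j {1} | betaSet-replicate-1 j
    | x∙yz≈y∙xz (c + j) 3 j | x∙yz≈y∙xz c 2 j | x∙yz≈y∙xz c 1 j = refl

  betaSet-β : betaSet β ≡ B₀
  betaSet-β = trans (cong (λ k → betaSet (c + j ∷ c ∷ c ∷ 4 ∷ replicate (k ∸ 2) 1)) α₁∸c≡2+j)
                    betaSet-[c+j,c,c,4,1ʲ]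

  χ-β-α : χ β α ≡ ℤ.+ 2 ℤ.* negOnePow (α₁ ∸ c)
  χ-β-α = begin
    χ β α                        ≡⟨ cong (λ B → mn B α) {betaSet β} {B₀} betaSet-β ⟩
    mn B₀ α                      ≡⟨ mn-B₀ ⟩
    ℤ.+ 2 ℤ.* negOnePow (2 + j)  ≡⟨ cong (λ k → ℤ.+ 2 ℤ.* negOnePow k) α₁∸c≡2+j ⟨
    ℤ.+ 2 ℤ.* negOnePow (α₁ ∸ c) ∎
    where open ≡-Reasoning

  hook-β : hook β 2 1 ≡ α₁
  hook-β = begin
    hook β 2 1                     ≡⟨ hook-[n,c,c,4,1ᵏ] (α₁ ∸ c ∸ 2) 4≤c (m≤m+n c j) ⟩
    c + (2 + (α₁ ∸ c ∸ 2))         ≡⟨ cong (λ k → c + (2 + (k ∸ 2))) α₁∸c≡2+j ⟩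
    c + (2 + j)                    ≡⟨ x∙yz≈y∙xz c 2 j ⟩
    α₁                             ∎
    where open ≡-Reasoning

  -- Equations instead of a substitution: the χ-part must match the goal syntactically,
  -- since comparing χ at merely definitionally equal arguments unfolds the whole recursion.
  conclusion : ∀ {a₁ a₂} → α₁ ≡ a₁ → α₂ ≡ a₂ → Conclusion a₁ a₂ c
  conclusion refl refl = isPartition-[n,c,c,4,1ᵏ] (α₁ ∸ c ∸ 2) 4≤c (m≤m+n c j) , hook-β , χ-β-α

∉Sign⇒4≤a₃ : ∀ {a₁ a₂ a₃} → a₁ ≡ suc a₂ → IsPartition (a₁ ∷ a₂ ∷ a₃ ∷ 1 ∷ []) →
             ¬ InSign (a₁ ∷ a₂ ∷ a₃ ∷ 1 ∷ []) → a₃ + 1 < a₂ → 1 < a₃ → 4 ≤ a₃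
∉Sign⇒4≤a₃ {a₂ = a₂} {2} refl α-partition α∉Sign 3<a₂ _ =
  ⊥-elim (α∉Sign (α-partition , [] , _ , refl , tt , st-a21 (suc a₂) (m≤n⇒m≤1+n 3<a₂)))
∉Sign⇒4≤a₃ {a₂ = a₂} {3} refl α-partition α∉Sign 4<a₂ _ =
  ⊥-elim (α∉Sign (α-partition , [] , _ , refl , tt , st-a31 (suc a₂) (m≤n⇒m≤1+n 4<a₂)))
∉Sign⇒4≤a₃ {a₃ = 0}     _ _ _ _ ()
∉Sign⇒4≤a₃ {a₃ = 1}     _ _ _ _ (s≤s ())
∉Sign⇒4≤a₃ {a₃ = suc (suc (suc (suc _)))} _ _ _ _ _ = s≤s (s≤s (s≤s (s≤s z≤n)))

theorem14 : (a₁ a₂ a₃ a₄ : ℕ) →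
    IsPartition (a₁ ∷ a₂ ∷ a₃ ∷ a₄ ∷ []) →
    ¬ InSign (a₁ ∷ a₂ ∷ a₃ ∷ a₄ ∷ []) →
    InSign (a₂ ∷ a₃ ∷ a₄ ∷ []) →
    a₂ < a₁ → a₃ + a₄ < a₂ →
    a₁ ∸ a₂ ≡ 1 → a₄ ≡ 1 → 1 < a₃ →
    IsPartition ((a₁ ∸ 2) ∷ a₃ ∷ a₃ ∷ 4 ∷ replicate (a₁ ∸ a₃ ∸ 2) 1)
    × hook ((a₁ ∸ 2) ∷ a₃ ∷ a₃ ∷ 4 ∷ replicate (a₁ ∸ a₃ ∸ 2) 1) 2 1 ≡ a₁
    × χ ((a₁ ∸ 2) ∷ a₃ ∷ a₃ ∷ 4 ∷ replicate (a₁ ∸ a₃ ∸ 2) 1) (a₁ ∷ a₂ ∷ a₃ ∷ a₄ ∷ [])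
        ≡ ℤ.+ 2 ℤ.* negOnePow (a₁ ∸ a₃)
theorem14 a₁ a₂ a₃ a₄ α-partition α∉Sign _ a₂<a₁ a₃+1<a₂ a₁∸a₂≡1 refl 1<a₃ =
  Character.conclusion 4≤a₃ (m<n⇒0<n∸m 1+a₃<a₂)
    (trans (cong suc 1+[a₃+j]≡a₂) (sym a₁≡1+a₂)) 1+[a₃+j]≡a₂
  where
  a₁≡1+a₂ : a₁ ≡ suc a₂
  a₁≡1+a₂ = trans (sym (m∸n+n≡m (<⇒≤ a₂<a₁))) (cong (_+ a₂) a₁∸a₂≡1)
  4≤a₃ : 4 ≤ a₃
  4≤a₃ = ∉Sign⇒4≤a₃ a₁≡1+a₂ α-partition α∉Sign a₃+1<a₂ 1<a₃
  1+a₃<a₂ : suc a₃ < a₂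
  1+a₃<a₂ = subst (_< a₂) (+-comm a₃ 1) a₃+1<a₂
  j : ℕ
  j = a₂ ∸ suc a₃
  1+[a₃+j]≡a₂ : suc (a₃ + j) ≡ a₂
  1+[a₃+j]≡a₂ = m+[n∸m]≡n (<⇒≤ 1+a₃<a₂)
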